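{- Let $S_n$ be the star of order $n$ (one center vertex adjacent to $n-1$ vertices of degree $1$). Then $$\eta(S_n)+\eta(\overline{S_n})<\eta(T)+\eta(\overline{T})$$ for all trees $T$ of order $n$ that are not isomorphic to $S_n$.
   Context: $\overline{G}$ denotes the complement of a graph $G$. $\eta(G)$ denotes the number of nonempty vertex subsets $S\subseteq V(G)$ such that the induced subgraph on $S$ is connected. -}

module Defs where

open import Data.Nat using (ℕ; zero; suc; _+_; _∸_)
open import Data.Bool using (Bool; true; false; _∧_; _∨_; not; if_then_else_)
open import Data.Fin using (Fin; zero; suc; inject₁; fromℕ)
open import Data.Fin.Properties using (_≟_)
open import Data.Vec using (Vec; []; _∷_; lookup)
open import Data.List using (List; []; _∷_; map; _++_; filter; length; allFin)
open import Data.Bool.ListAction using (any; all)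
open import Data.Product using (Σ; _×_; ∃)
open import Data.Bool.Properties using (T?)
open import Relation.Nullary using (¬_)
open import Relation.Nullary.Decidable using (⌊_⌋)
open import Relation.Binary.PropositionalEquality using (_≡_)
open import Function.Definitions using (Injective)
open import Data.Fin.Permutation using (Permutation′; _⟨$⟩ʳ_)
open import Data.Bool using (T)

-- A (loopless, undirected) graph on vertex set Fin n, given by its adjacency
-- function.  Simplicity (symmetry, irreflexivity) is imposed as hypotheses.
Graph : ℕ → Set
Graph n = Fin n → Fin n → Bool

Symmetric : ∀ {n} → Graph n → Set
Symmetric {n} G = (i j : Fin n) → G i j ≡ G j i

Irreflexive : ∀ {n} → Graph n → Set
Irreflexive {n} G = (i : Fin n) → G i i ≡ false

SimpleGraph : ∀ {n} → Graph n → Set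
SimpleGraph G = Symmetric G × Irreflexive G

_==_ : ∀ {n} → Fin n → Fin n → Bool
i == j = ⌊ i ≟ j ⌋

complement : ∀ {n} → Graph n → Graph n
complement G i j = not (G i j) ∧ not (i == j)

star : (m : ℕ) → Graph (suc m)
star m zero    zero    = false
star m zero    (suc _) = true
star m (suc _) zero    = true
star m (suc _) (suc _) = false

-- vertex subsets as characteristic vectors
VSet : ℕ → Set
VSet n = Vec Bool n

_∈ᵇ_ : ∀ {n} → Fin n → VSet n → Bool
i ∈ᵇ S = lookup S i

-- list of all 2^n subsets of Fin n (each exactly once)
subsets : (n : ℕ) → List (VSet n)
subsets zero    = [] ∷ []
subsets (suc n) = map (false ∷_) (subsets n) ++ map (true ∷_) (subsets n)

nonempty : ∀ {n} → VSet n → Bool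
nonempty {n} S = any (_∈ᵇ S) (allFin n)

-- walkWithin G S k u v : there is a walk of length ≤ k from u to v in G
-- all of whose vertices lie in S (u assumed in S)
walkWithin : ∀ {n} → Graph n → VSet n → ℕ → Fin n → Fin n → Bool
walkWithin G S zero    u v = u == v
walkWithin {n} G S (suc k) u v =
  (u == v) ∨ any (λ w → (w ∈ᵇ S) ∧ (G u w ∧ walkWithin G S k w v)) (allFin n)

-- the induced subgraph G[S] is connected (and S nonempty): any two vertices
-- of S are joined by a walk inside S (walks of length ≤ n suffice, since any
-- walk contains a path, which has length < n)
inducedConnected : ∀ {n} → Graph n → VSet n → Bool
inducedConnected {n} G S =
  nonempty S ∧
  all (λ u → not (u ∈ᵇ S) ∨
        all (λ v → not (v ∈ᵇ S) ∨ walkWithin G S n u v) (allFin n))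
      (allFin n)

η : ∀ {n} → Graph n → ℕ
η {n} G = length (filter (λ S → T? (inducedConnected G S)) (subsets n))

fullSet : (n : ℕ) → VSet n
fullSet zero    = []
fullSet (suc n) = true ∷ fullSet n

Connected : ∀ {n} → Graph n → Set
Connected {n} G = (u v : Fin n) → T (walkWithin G (fullSet n) n u v)

Cycle : ∀ {n} → Graph n → Set
Cycle {n} G = Σ ℕ λ k → Σ (Fin (3 + k) → Fin n) λ c →
  Injective _≡_ _≡_ c ×
  ((i : Fin (2 + k)) → G (c (inject₁ i)) (c (suc i)) ≡ true) ×
  (G (c (fromℕ (2 + k))) (c zero) ≡ true)

Acyclic : ∀ {n} → Graph n → Set
Acyclic G = ¬ Cycle G

IsTree : ∀ {n} → Graph n → Set
IsTree G = SimpleGraph G × Connected G × Acyclic G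

Isomorphic : ∀ {n} → Graph n → Graph n → Set
Isomorphic {n} G H = Σ (Permutation′ n) λ π →
  (i j : Fin n) → H (π ⟨$⟩ʳ i) (π ⟨$⟩ʳ j) ≡ G i j

-- For a graph G and a vertex set S let score G S ∈ {0,1,2} count how many of
-- G[S] and Ḡ[S] are connected.  Then η G + η Ḡ is the sum of score G S over
-- all subsets S, and the theorem follows from a pointwise comparison.
--
--  * Every graph: a singleton S has score 2, and for nonempty S at least one
--    of G[S], Ḡ[S] is connected, so the score is ≥ 1.
--  * The star: G[S] and Ḡ[S] are both connected only when |S| = 1, so the
--    star's score is pointwise minimal, and ≤ 1 on sets with two vertices.
--  * A tree that is not a star contains a path a-b-c-d on four vertices; in a
--    tree it is induced, and an induced P₄ is self-complementary, so the tree
--    has score 2 on {a,b,c,d}: the comparison is strict there.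
--  * Conversely a connected triangle-free graph with no such path has a
--    vertex adjacent to all others, and is then isomorphic to the star.
module Submission where

open import Defs
open import Data.Nat using (ℕ; zero; suc; _+_; _<_; _≤_; z≤n; s≤s)
open import Data.Nat.Properties
  using (≤-refl; ≤-trans; +-comm; m≤n+m; +-mono-≤; +-mono-<-≤; +-mono-≤-<; <-≤-trans; ≤-reflexive)
open import Data.Nat.ListAction using (sum)
open import Data.Nat.Solver using (module +-*-Solver)
open import Data.Bool using (Bool; true; false; _∧_; _∨_; not)
open import Data.Bool.Properties using (T?; T-≡; ∨-zeroʳ; ¬-not) renaming (_≟_ to _≟ᵇ_)
open import Data.Bool.ListAction using (any; all)
open import Data.Fin using (Fin; zero; suc; inject₁)
open import Data.Fin.Properties using (_≟_; any?; injective⇒≤)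
open import Data.Fin.Permutation using (_⟨$⟩ʳ_; transpose)
open import Data.List using (List; []; _∷_; map; filter; length; allFin)
open import Data.List.Membership.Propositional using (_∈_; lose; find)
open import Data.List.Membership.Propositional.Properties using (∈-allFin; ∈-++⁺ˡ; ∈-++⁺ʳ; ∈-map⁺)
open import Data.List.Relation.Unary.Any using (here; there)
import Data.List.Relation.Unary.All as All
open import Data.List.Relation.Unary.Any.Properties using (any⁺; any⁻)
open import Data.List.Relation.Unary.All.Properties using (all⁺; all⁻)
open import Data.Vec using (Vec; []; _∷_; lookup; tabulate)
open import Data.Vec.Properties using (lookup∘tabulate)
open import Data.Vec.Relation.Unary.All using ([]; _∷_)
open import Data.Vec.Relation.Unary.Unique.Propositional using (Unique; []; _∷_)
open import Data.Vec.Relation.Unary.Unique.Propositional.Properties using (lookup-injective)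
open import Data.Product using (Σ; ∃; _×_; _,_; proj₁; proj₂)
open import Data.Sum using (_⊎_; inj₁; inj₂)
open import Data.Empty using (⊥; ⊥-elim)
open import Function.Bundles using (Equivalence)
open import Relation.Nullary using (¬_; Dec; yes; no; ¬?; _×-dec_)
open import Relation.Nullary.Decidable using (isYes≗does; dec-true; dec-false; toWitness; map′)
open import Relation.Binary.PropositionalEquality
  using (_≡_; _≢_; refl; sym; trans; cong; cong₂; subst; subst₂; ≢-sym; module ≡-Reasoning)

open Equivalence using (to; from)

true≢false : true ≢ false
true≢false ()

∨-elim : ∀ a b → a ∨ b ≡ true → a ≡ true ⊎ b ≡ true
∨-elim true  b _ = inj₁ refl
∨-elim false b p = inj₂ p

∧-elim : ∀ a b → a ∧ b ≡ true → a ≡ true × b ≡ true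
∧-elim true  true  _ = refl , refl
∧-elim true  false ()
∧-elim false b     ()

==-sound : ∀ {n} {i j : Fin n} → i == j ≡ true → i ≡ j
==-sound {i = i} {j} p = toWitness {a? = i ≟ j} (from T-≡ p)

==-refl : ∀ {n} (i : Fin n) → i == i ≡ true
==-refl i = trans (isYes≗does (i ≟ i)) (dec-true (i ≟ i) refl)

==-false : ∀ {n} {i j : Fin n} → i ≢ j → i == j ≡ false
==-false {i = i} {j} i≢j = trans (isYes≗does (i ≟ j)) (dec-false (i ≟ j) i≢j)

-- deciding vertex equality without abstracting `i ≟ j` out of the goal
-- (walkWithin mentions it after unfolding)
≡-or-≢ : ∀ {n} (i j : Fin n) → i ≡ j ⊎ i ≢ j
≡-or-≢ i j with i ≟ j
... | yes i≡j = inj₁ i≡j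
... | no  i≢j = inj₂ i≢j

==-sym : ∀ {n} (i j : Fin n) → i == j ≡ j == i
==-sym i j with i ≟ j
... | yes refl = sym (==-refl i)
... | no  i≢j  = sym (==-false (≢-sym i≢j))

module _ {A : Set} (p : A → Bool) where

  any-intro : ∀ {x xs} → x ∈ xs → p x ≡ true → any p xs ≡ true
  any-intro x∈ px = to T-≡ (any⁺ p (lose x∈ (from T-≡ px)))

  any-elim : ∀ xs → any p xs ≡ true → Σ A λ x → x ∈ xs × p x ≡ true
  any-elim xs q with find (any⁻ p xs (from T-≡ q))
  ... | x , x∈ , px = x , x∈ , to T-≡ px

  all-intro : ∀ xs → (∀ x → p x ≡ true) → all p xs ≡ true
  all-intro xs f = to T-≡ (all⁻ p (All.universal (λ x → from T-≡ (f x)) xs))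

  all-elim : ∀ {x xs} → all p xs ≡ true → x ∈ xs → p x ≡ true
  all-elim {xs = xs} q x∈ = to T-≡ (All.lookup (all⁺ p xs (from T-≡ q)) x∈)

  all-false : ∀ xs → all p xs ≡ false → Σ A λ x → p x ≡ false
  all-false []       ()
  all-false (y ∷ xs) q with p y in py
  ... | false = y , py
  ... | true  = all-false xs q

module Walk {n} (G : Graph n) (S : VSet n) where

  walk : ℕ → Fin n → Fin n → Bool
  walk = walkWithin G S

  stay : ∀ k u → walk k u u ≡ true
  stay zero    u = ==-refl u
  stay (suc k) u rewrite ==-refl u = refl

  stay⁻ : ∀ {u v} → walk 0 u v ≡ true → u ≡ v
  stay⁻ = ==-sound

  step : ∀ {k u w v} → G u w ≡ true → w ∈ᵇ S ≡ true → walk k w v ≡ true → walk (suc k) u v ≡ true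
  step {k} {u} {w} {v} uw w∈S rest =
    trans (cong ((u == v) ∨_) (any-intro (λ z → (z ∈ᵇ S) ∧ (G u z ∧ walk k z v)) (∈-allFin w) w-ok))
          (∨-zeroʳ (u == v))
    where
    w-ok : (w ∈ᵇ S) ∧ (G u w ∧ walk k w v) ≡ true
    w-ok rewrite w∈S | uw | rest = refl

  step⁻ : ∀ {k u v} → walk (suc k) u v ≡ true →
          u ≡ v ⊎ Σ (Fin n) λ w → w ∈ᵇ S ≡ true × G u w ≡ true × walk k w v ≡ true
  step⁻ {k} {u} {v} q with ∨-elim (u == v) _ q
  ... | inj₁ u=v = inj₁ (==-sound u=v)
  ... | inj₂ r with any-elim (λ z → (z ∈ᵇ S) ∧ (G u z ∧ walk k z v)) (allFin n) r
  ... | w , _ , t with ∧-elim (w ∈ᵇ S) _ t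
  ... | w∈S , t′ with ∧-elim (G u w) _ t′
  ... | uw , rest = inj₂ (w , w∈S , uw , rest)

  edge : ∀ {u v} → G u v ≡ true → v ∈ᵇ S ≡ true → walk 1 u v ≡ true
  edge {v = v} uv v∈S = step {k = 0} uv v∈S (stay 0 v)

  lengthen : ∀ {k k′ u v} → k ≤ k′ → walk k u v ≡ true → walk k′ u v ≡ true
  lengthen {zero}  {k′} {u} z≤n p with stay⁻ p
  ... | refl = stay k′ u
  lengthen {suc k} {suc k′} {u} (s≤s k≤k′) p with step⁻ {k} p
  ... | inj₁ refl = stay (suc k′) u
  ... | inj₂ (w , w∈S , uw , rest) = step {k = k′} uw w∈S (lengthen {k} k≤k′ rest)

  concat : ∀ {k₁ k₂ u w v} → walk k₁ u w ≡ true → walk k₂ w v ≡ true → walk (k₁ + k₂) u v ≡ true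
  concat {zero} p q with stay⁻ p
  ... | refl = q
  concat {suc k₁} {k₂} p q with step⁻ {k₁} p
  ... | inj₁ refl = lengthen {k₂} (m≤n+m k₂ (suc k₁)) q
  ... | inj₂ (z , z∈S , uz , rest) = step {k = k₁ + k₂} uz z∈S (concat {k₁} rest q)

  reverse : Symmetric G → ∀ {k u v} → u ∈ᵇ S ≡ true → walk k u v ≡ true → walk k v u ≡ true
  reverse symG {zero} {u} _ p with stay⁻ p
  ... | refl = stay 0 u
  reverse symG {suc k} {u} {v} u∈S p with step⁻ {k} p
  ... | inj₁ refl = stay (suc k) u
  ... | inj₂ (w , w∈S , uw , rest) =
    subst (λ l → walk l v u ≡ true) (+-comm k 1)
          (concat {k} (reverse symG {k} w∈S rest) (edge (trans (symG w u) uw) u∈S))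

  first-step : ∀ {k u v} → walk k u v ≡ true → u ≢ v → Σ (Fin n) λ w → w ∈ᵇ S ≡ true × G u w ≡ true
  first-step {zero}  p u≢v = ⊥-elim (u≢v (stay⁻ p))
  first-step {suc k} p u≢v with step⁻ {k} p
  ... | inj₁ u≡v = ⊥-elim (u≢v u≡v)
  ... | inj₂ (w , w∈S , uw , _) = w , w∈S , uw

  transport : (R : Fin n → Set) → (∀ {w z} → R w → G w z ≡ true → R z) →
              ∀ k {u v} → R u → walk k u v ≡ true → R v
  transport R closed zero    Ru p with stay⁻ p
  ... | refl = Ru
  transport R closed (suc k) Ru p with step⁻ {k} p
  ... | inj₁ refl = Ru
  ... | inj₂ (w , _ , uw , rest) = transport R closed k (closed Ru uw) rest

module Conn {n} (G : Graph n) (S : VSet n) where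
  open Walk G S

  Joined : Set
  Joined = ∀ u v → u ∈ᵇ S ≡ true → v ∈ᵇ S ≡ true → walk n u v ≡ true

  member⇒nonempty : ∀ {u} → u ∈ᵇ S ≡ true → nonempty S ≡ true
  member⇒nonempty {u} = any-intro (_∈ᵇ S) (∈-allFin u)

  connected-intro : nonempty S ≡ true → Joined → inducedConnected G S ≡ true
  connected-intro ne joined rewrite ne = all-intro _ (allFin n) row
    where
    entry : ∀ u → u ∈ᵇ S ≡ true → ∀ v → (not (v ∈ᵇ S) ∨ walk n u v) ≡ true
    entry u u∈S v with v ∈ᵇ S in v∈S
    ... | false = refl
    ... | true  = joined u v u∈S v∈S
    row : ∀ u → (not (u ∈ᵇ S) ∨ all (λ v → not (v ∈ᵇ S) ∨ walk n u v) (allFin n)) ≡ true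
    row u with u ∈ᵇ S in u∈S
    ... | false = refl
    ... | true  = all-intro _ (allFin n) (entry u u∈S)

  connected⇒nonempty : inducedConnected G S ≡ true → nonempty S ≡ true
  connected⇒nonempty c = proj₁ (∧-elim (nonempty S) _ c)

  connected⇒joined : inducedConnected G S ≡ true → Joined
  connected⇒joined c u v u∈S v∈S
    with all-elim _ (proj₂ (∧-elim (nonempty S) _ c)) (∈-allFin u)
  ... | from-u rewrite u∈S with all-elim _ from-u (∈-allFin v)
  ... | u-to-v rewrite v∈S = u-to-v

  disconnected⇒separated : inducedConnected G S ≡ false → nonempty S ≡ true →
    Σ (Fin n) λ u → Σ (Fin n) λ v → u ∈ᵇ S ≡ true × v ∈ᵇ S ≡ true × walk n u v ≡ false
  disconnected⇒separated c ne rewrite ne with all-false _ (allFin n) c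
  ... | u , q with u ∈ᵇ S in u∈S
  ... | true with all-false _ (allFin n) q
  ... | v , r with v ∈ᵇ S in v∈S
  ... | true = u , v , u∈S , v∈S , r

indicator : Bool → ℕ
indicator true  = 1
indicator false = 0

score : ∀ {n} → Graph n → VSet n → ℕ
score G S = indicator (inducedConnected G S) + indicator (inducedConnected (complement G) S)

length-filter : ∀ {A : Set} (p : A → Bool) xs →
  length (filter (λ x → T? (p x)) xs) ≡ sum (map (λ x → indicator (p x)) xs)
length-filter p [] = refl
length-filter p (x ∷ xs) with p x
... | true  = cong suc (length-filter p xs)
... | false = length-filter p xs

sum-map-+ : ∀ {A : Set} (f g : A → ℕ) xs →
  sum (map f xs) + sum (map g xs) ≡ sum (map (λ x → f x + g x) xs)
sum-map-+ f g [] = refl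
sum-map-+ f g (x ∷ xs) = begin
    (f x + sum (map f xs)) + (g x + sum (map g xs))
  ≡⟨ interchange (f x) (sum (map f xs)) (g x) (sum (map g xs)) ⟩
    (f x + g x) + (sum (map f xs) + sum (map g xs))
  ≡⟨ cong ((f x + g x) +_) (sum-map-+ f g xs) ⟩
    (f x + g x) + sum (map (λ x → f x + g x) xs)
  ∎
  where
  open ≡-Reasoning
  open +-*-Solver
  interchange : ∀ a b c d → (a + b) + (c + d) ≡ (a + c) + (b + d)
  interchange = solve 4 (λ a b c d → (a :+ b) :+ (c :+ d) := (a :+ c) :+ (b :+ d)) refl

η-as-score-sum : ∀ {n} (G : Graph n) → η G + η (complement G) ≡ sum (map (score G) (subsets n))
η-as-score-sum {n} G = begin
    η G + η (complement G)
  ≡⟨ cong₂ _+_ (length-filter (inducedConnected G) (subsets n))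
               (length-filter (inducedConnected (complement G)) (subsets n)) ⟩
    sum (map (λ S → indicator (inducedConnected G S)) (subsets n))
      + sum (map (λ S → indicator (inducedConnected (complement G) S)) (subsets n))
  ≡⟨ sum-map-+ _ _ (subsets n) ⟩
    sum (map (score G) (subsets n))
  ∎
  where open ≡-Reasoning

sum-map-≤ : ∀ {A : Set} (f g : A → ℕ) → (∀ x → f x ≤ g x) → ∀ xs → sum (map f xs) ≤ sum (map g xs)
sum-map-≤ f g f≤g []       = z≤n
sum-map-≤ f g f≤g (x ∷ xs) = +-mono-≤ (f≤g x) (sum-map-≤ f g f≤g xs)

sum-map-< : ∀ {A : Set} (f g : A → ℕ) → (∀ x → f x ≤ g x) → ∀ {x₀ xs} → x₀ ∈ xs → f x₀ < g x₀ →
  sum (map f xs) < sum (map g xs)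
sum-map-< f g f≤g {xs = x ∷ xs} (here refl) lt = +-mono-<-≤ lt (sum-map-≤ f g f≤g xs)
sum-map-< f g f≤g {xs = x ∷ xs} (there x₀∈) lt = +-mono-≤-< (f≤g x) (sum-map-< f g f≤g x₀∈ lt)

subsets-complete : ∀ n (S : VSet n) → S ∈ subsets n
subsets-complete zero    []      = here refl
subsets-complete (suc n) (false ∷ S) = ∈-++⁺ˡ (∈-map⁺ (false ∷_) (subsets-complete n S))
subsets-complete (suc n) (true ∷ S)  =
  ∈-++⁺ʳ (map (false ∷_) (subsets n)) (∈-map⁺ (true ∷_) (subsets-complete n S))

η-sum-< : ∀ {n} (G H : Graph n) → (∀ S → score G S ≤ score H S) → ∀ S₀ → score G S₀ < score H S₀ →
  η G + η (complement G) < η H + η (complement H)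
η-sum-< {n} G H G≤H S₀ lt =
  subst₂ _<_ (sym (η-as-score-sum G)) (sym (η-as-score-sum H))
    (sum-map-< (score G) (score H) G≤H (subsets-complete n S₀) lt)

complement-symmetric : ∀ {n} {G : Graph n} → Symmetric G → Symmetric (complement G)
complement-symmetric symG i j rewrite symG i j | ==-sym i j = refl

complement-edge : ∀ {n} (G : Graph n) {x y} → G x y ≡ false → x ≢ y → complement G x y ≡ true
complement-edge G xy x≢y rewrite xy | ==-false x≢y = refl

hub-connected : ∀ {n} (H : Graph n) (S : VSet n) → Symmetric H → ∀ k {h} → k + k ≤ n →
  h ∈ᵇ S ≡ true → (∀ x → x ∈ᵇ S ≡ true → walkWithin H S k x h ≡ true) →
  inducedConnected H S ≡ true
hub-connected H S symH k 2k≤n h∈S toHub =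
  connected-intro (member⇒nonempty h∈S) λ x y x∈S y∈S →
    lengthen {k + k} 2k≤n (concat {k} (toHub x x∈S) (reverse symH {k} y∈S (toHub y y∈S)))
  where
  open Walk H S
  open Conn H S

singleton-connected : ∀ {n} (G : Graph n) (S : VSet n) → nonempty S ≡ true →
  (∀ u v → u ∈ᵇ S ≡ true → v ∈ᵇ S ≡ true → u ≡ v) → inducedConnected G S ≡ true
singleton-connected {n} G S ne single = Conn.connected-intro G S ne λ u v u∈S v∈S →
  subst (λ w → walkWithin G S n u w ≡ true) (single u v u∈S v∈S) (Walk.stay G S n u)

score-singleton : ∀ {n} (G : Graph n) (S : VSet n) → nonempty S ≡ true →
  (∀ u v → u ∈ᵇ S ≡ true → v ∈ᵇ S ≡ true → u ≡ v) → score G S ≡ 2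
score-singleton G S ne single =
  cong₂ (λ a b → indicator a + indicator b)
        (singleton-connected G S ne single) (singleton-connected (complement G) S ne single)

-- If G[S] is disconnected then Ḡ[S] is connected: take vertices u, v of S
-- not joined in G[S]; every vertex of S reaches u in Ḡ[S] within two steps.
complement-connected : ∀ {n} (G : Graph n) (S : VSet n) → Symmetric G → 4 ≤ n →
  nonempty S ≡ true → inducedConnected G S ≡ false → inducedConnected (complement G) S ≡ true
complement-connected {n} G S symG 4≤n ne disc with Conn.disconnected⇒separated G S disc ne
... | u , v , u∈S , v∈S , noWalk =
  hub-connected Ḡ S (complement-symmetric symG) 2 4≤n u∈S toU
  where
  Ḡ = complement G
  module WG = Walk G S
  module WḠ = Walk Ḡ S

  no-short-walk : ∀ k → k ≤ n → WG.walk k u v ≡ true → ⊥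
  no-short-walk k k≤n w = true≢false (trans (sym (WG.lengthen {k} k≤n w)) noWalk)

  u≢v : u ≢ v
  u≢v refl = no-short-walk 0 z≤n (WG.stay 0 u)

  vu : G v u ≡ false
  vu = trans (symG v u) (¬-not λ uv → no-short-walk 1 (≤-trans (s≤s z≤n) 4≤n) (WG.edge uv v∈S))

  toU : ∀ x → x ∈ᵇ S ≡ true → WḠ.walk 2 x u ≡ true
  toU x x∈S with ≡-or-≢ x u
  ... | inj₁ refl = WḠ.stay 2 x
  ... | inj₂ x≢u with G x u in xu
  ...   | false = WḠ.lengthen {1} {2} (s≤s z≤n) (WḠ.edge (complement-edge G xu x≢u) u∈S)
  ...   | true  = WḠ.step {k = 1} (complement-edge G xv x≢v) v∈S
                    (WḠ.edge (complement-edge G vu (≢-sym u≢v)) u∈S)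
    where
    -- x cannot be a common neighbour of u and v
    xv : G x v ≡ false
    xv = ¬-not λ xv → no-short-walk 2 (≤-trans (s≤s (s≤s z≤n)) 4≤n)
           (WG.step {k = 1} (trans (symG u x) xu) x∈S (WG.edge xv v∈S))
    x≢v : x ≢ v
    x≢v refl = true≢false (trans (sym xu) vu)

score-positive : ∀ {n} (G : Graph n) (S : VSet n) → Symmetric G → 4 ≤ n →
  nonempty S ≡ true → 1 ≤ score G S
score-positive G S symG 4≤n ne = by-cases refl refl
  where
  by-cases : ∀ {a b} → inducedConnected G S ≡ a → inducedConnected (complement G) S ≡ b →
             1 ≤ indicator a + indicator b
  by-cases {true}          _    _  = s≤s z≤n
  by-cases {false} {true}  _    _  = s≤s z≤n
  by-cases {false} {false} disc co =
    ⊥-elim (true≢false (trans (sym (complement-connected G S symG 4≤n ne disc)) co))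

isolated⇒alone : ∀ {n} (H : Graph n) (S : VSet n) → inducedConnected H S ≡ true →
  ∀ {u} → u ∈ᵇ S ≡ true → (∀ x → x ∈ᵇ S ≡ true → H u x ≡ false) →
  ∀ v → v ∈ᵇ S ≡ true → u ≡ v
isolated⇒alone {n} H S conn {u} u∈S isolated v v∈S with ≡-or-≢ u v
... | inj₁ u≡v = u≡v
... | inj₂ u≢v with Walk.first-step H S {n} (Conn.connected⇒joined H S conn u v u∈S v∈S) u≢v
... | w , w∈S , uw = ⊥-elim (true≢false (trans (sym uw) (isolated w w∈S)))

co-star-centre : ∀ m (x : Fin (suc m)) → complement (star m) zero x ≡ false
co-star-centre m zero    = refl
co-star-centre m (suc x) = refl

-- For the star G, G[S] and Ḡ[S] are both connected only if |S| ≤ 1: if the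
-- centre is in S it is isolated in Ḡ[S]; otherwise S is independent in G.
star-both-connected : ∀ m (S : VSet (suc m)) → inducedConnected (star m) S ≡ true →
  inducedConnected (complement (star m)) S ≡ true →
  ∀ u v → u ∈ᵇ S ≡ true → v ∈ᵇ S ≡ true → u ≡ v
star-both-connected m S c c̄ u v u∈S v∈S = by-centre (zero ∈ᵇ S) refl
  where
  by-centre : ∀ b → zero ∈ᵇ S ≡ b → u ≡ v
  by-centre true centre∈S = trans (sym (centre-alone u u∈S)) (centre-alone v v∈S)
    where
    centre-alone : ∀ w → w ∈ᵇ S ≡ true → zero ≡ w
    centre-alone = isolated⇒alone (complement (star m)) S c̄ centre∈S (λ x _ → co-star-centre m x)
  by-centre false centre∉S = isolated⇒alone (star m) S c u∈S (leaf-isolated u u∈S) v v∈S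
    where
    leaf-isolated : ∀ u → u ∈ᵇ S ≡ true → ∀ x → x ∈ᵇ S ≡ true → star m u x ≡ false
    leaf-isolated zero    u∈S = ⊥-elim (true≢false (trans (sym u∈S) centre∉S))
    leaf-isolated (suc u) _ zero    x∈S = ⊥-elim (true≢false (trans (sym x∈S) centre∉S))
    leaf-isolated (suc u) _ (suc x) _   = refl

star-score≤1 : ∀ m (S : VSet (suc m)) {u v} → u ∈ᵇ S ≡ true → v ∈ᵇ S ≡ true → u ≢ v →
  score (star m) S ≤ 1
star-score≤1 m S {u} {v} u∈S v∈S u≢v = by-cases refl refl
  where
  by-cases : ∀ {a b} → inducedConnected (star m) S ≡ a →
             inducedConnected (complement (star m)) S ≡ b → indicator a + indicator b ≤ 1
  by-cases {true}  {true}  c c̄ = ⊥-elim (u≢v (star-both-connected m S c c̄ u v u∈S v∈S))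
  by-cases {true}  {false} _ _ = ≤-refl
  by-cases {false} {true}  _ _ = ≤-refl
  by-cases {false} {false} _ _ = z≤n

star-score-minimal : ∀ m (G : Graph (suc m)) → Symmetric G → 4 ≤ suc m →
  ∀ S → score (star m) S ≤ score G S
star-score-minimal m G symG 4≤n S = by-cases refl refl
  where
  by-cases : ∀ {a b} → inducedConnected (star m) S ≡ a →
             inducedConnected (complement (star m)) S ≡ b → indicator a + indicator b ≤ score G S
  by-cases {true}  {true}  c c̄ = ≤-reflexive (sym
    (score-singleton G S (Conn.connected⇒nonempty (star m) S c) (star-both-connected m S c c̄)))
  by-cases {true}  {false} c _ = score-positive G S symG 4≤n (Conn.connected⇒nonempty (star m) S c)
  by-cases {false} {true}  _ c̄ =
    score-positive G S symG 4≤n (Conn.connected⇒nonempty (complement (star m)) S c̄)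
  by-cases {false} {false} _ _ = z≤n

edge⇒≢ : ∀ {n} (G : Graph n) → Irreflexive G → ∀ {i j} → G i j ≡ true → i ≢ j
edge⇒≢ G irr {i} ij refl = true≢false (trans (sym ij) (irr i))

setOf : ∀ {n} → List (Fin n) → VSet n
setOf xs = tabulate (λ i → any (i ==_) xs)

∈-setOf⁺ : ∀ {n} {x : Fin n} xs → x ∈ xs → x ∈ᵇ setOf xs ≡ true
∈-setOf⁺ {x = x} xs x∈ = trans (lookup∘tabulate _ x) (any-intro (x ==_) x∈ (==-refl x))

∈-setOf⁻ : ∀ {n} {x : Fin n} xs → x ∈ᵇ setOf xs ≡ true → x ∈ xs
∈-setOf⁻ {x = x} xs p with any-elim (x ==_) xs (trans (sym (lookup∘tabulate _ x)) p)
... | y , y∈ , x=y = subst (_∈ xs) (sym (==-sound x=y)) y∈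

record Path4 {n} (G : Graph n) : Set where
  constructor path4
  field
    a b c d : Fin n
    ab : G a b ≡ true
    bc : G b c ≡ true
    cd : G c d ≡ true
    a≢c : a ≢ c
    b≢d : b ≢ d
    a≢d : a ≢ d

  vertices : List (Fin n)
  vertices = a ∷ b ∷ c ∷ d ∷ []

  distinct : Irreflexive G → Unique (a ∷ b ∷ c ∷ d ∷ [])
  distinct irr = (edge⇒≢ G irr ab ∷ a≢c ∷ a≢d ∷ [])
               ∷ (edge⇒≢ G irr bc ∷ b≢d ∷ []) ∷ (edge⇒≢ G irr cd ∷ []) ∷ [] ∷ []

  order≥4 : Irreflexive G → 4 ≤ n
  order≥4 irr = injective⇒≤ λ {i} {j} → lookup-injective (distinct irr) i j

path4? : ∀ {n} (G : Graph n) → Dec (Path4 G)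
path4? {n} G = map′ pack unpack
  (any? λ a → any? λ b → any? λ c → any? λ d →
     (G a b ≟ᵇ true) ×-dec (G b c ≟ᵇ true) ×-dec (G c d ≟ᵇ true) ×-dec
     ¬? (a ≟ c) ×-dec ¬? (b ≟ d) ×-dec ¬? (a ≟ d))
  where
  Witness : Set
  Witness = ∃ λ a → ∃ λ b → ∃ λ c → ∃ λ (d : Fin n) →
    G a b ≡ true × G b c ≡ true × G c d ≡ true × a ≢ c × b ≢ d × a ≢ d
  pack : Witness → Path4 G
  pack (a , b , c , d , ab , bc , cd , a≢c , b≢d , a≢d) = path4 a b c d ab bc cd a≢c b≢d a≢d
  unpack : Path4 G → Witness
  unpack p = a , b , c , d , ab , bc , cd , a≢c , b≢d , a≢d
    where open Path4 p

-- An induced path a-b-c-d is self-complementary: Ḡ contains the path c-a-d-b.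
-- Hence both G and Ḡ induce connected graphs on {a,b,c,d}, the first with
-- hub b and the second with hub a.
induced-path4-score : ∀ {n} (G : Graph n) → Symmetric G → Irreflexive G → (p : Path4 G) →
  let open Path4 p in G c a ≡ false → G a d ≡ false → G d b ≡ false →
  score G (setOf vertices) ≡ 2
induced-path4-score {n} G symG irr p ca ad db =
  cong₂ (λ x y → indicator x + indicator y) G-connected Ḡ-connected
  where
  open Path4 p
  S = setOf vertices
  Ḡ = complement G
  4≤n = order≥4 irr
  a∈S : a ∈ᵇ S ≡ true
  a∈S = ∈-setOf⁺ vertices (here refl)
  b∈S : b ∈ᵇ S ≡ true
  b∈S = ∈-setOf⁺ vertices (there (here refl))
  c∈S : c ∈ᵇ S ≡ true
  c∈S = ∈-setOf⁺ vertices (there (there (here refl)))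
  d∈S : d ∈ᵇ S ≡ true
  d∈S = ∈-setOf⁺ vertices (there (there (there (here refl))))

  G-connected : inducedConnected G S ≡ true
  G-connected = hub-connected G S symG 2 4≤n b∈S toB
    where
    open Walk G S
    toB : ∀ x → x ∈ᵇ S ≡ true → walk 2 x b ≡ true
    toB x x∈S with ∈-setOf⁻ vertices x∈S
    ... | here refl                         = lengthen {1} {2} (s≤s z≤n) (edge ab b∈S)
    ... | there (here refl)                 = stay 2 b
    ... | there (there (here refl))         = lengthen {1} {2} (s≤s z≤n) (edge (trans (symG c b) bc) b∈S)
    ... | there (there (there (here refl))) =
      step {k = 1} (trans (symG d c) cd) c∈S (edge (trans (symG c b) bc) b∈S)

  Ḡ-connected : inducedConnected Ḡ S ≡ true
  Ḡ-connected = hub-connected Ḡ S (complement-symmetric symG) 2 4≤n a∈S toA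
    where
    open Walk Ḡ S
    ca′ : Ḡ c a ≡ true
    ca′ = complement-edge G ca (≢-sym a≢c)
    da′ : Ḡ d a ≡ true
    da′ = complement-edge G (trans (symG d a) ad) (≢-sym a≢d)
    bd′ : Ḡ b d ≡ true
    bd′ = complement-edge G (trans (symG b d) db) b≢d
    toA : ∀ x → x ∈ᵇ S ≡ true → walk 2 x a ≡ true
    toA x x∈S with ∈-setOf⁻ vertices x∈S
    ... | here refl                         = stay 2 a
    ... | there (here refl)                 = step {k = 1} bd′ d∈S (edge da′ a∈S)
    ... | there (there (here refl))         = lengthen {1} {2} (s≤s z≤n) (edge ca′ a∈S)
    ... | there (there (there (here refl))) = lengthen {1} {2} (s≤s z≤n) (edge da′ a∈S)

TriangleFree : ∀ {n} → Graph n → Set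
TriangleFree G = ∀ {a b c} → G a b ≡ true → G b c ≡ true → G c a ≡ true → ⊥

acyclic⇒triangle-free : ∀ {n} (G : Graph n) → Irreflexive G → Acyclic G → TriangleFree G
acyclic⇒triangle-free G irr acyc {a} {b} {c} ab bc ca =
  acyc (0 , lookup vs , (λ {i} {j} → lookup-injective distinct i j) , edges , ca)
  where
  vs : Vec _ 3
  vs = a ∷ b ∷ c ∷ []
  distinct : Unique vs
  distinct = (edge⇒≢ G irr ab ∷ ≢-sym (edge⇒≢ G irr ca) ∷ [])
           ∷ (edge⇒≢ G irr bc ∷ []) ∷ [] ∷ []
  edges : (i : Fin 2) → G (lookup vs (inject₁ i)) (lookup vs (suc i)) ≡ true
  edges zero       = ab
  edges (suc zero) = bc

acyclic⇒square-free : ∀ {n} (G : Graph n) → Irreflexive G → Acyclic G →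
  ∀ {a b c d} → G a b ≡ true → G b c ≡ true → G c d ≡ true → G d a ≡ true → a ≢ c → b ≢ d → ⊥
acyclic⇒square-free G irr acyc {a} {b} {c} {d} ab bc cd da a≢c b≢d =
  acyc (1 , lookup vs , (λ {i} {j} → lookup-injective distinct i j) , edges , da)
  where
  vs : Vec _ 4
  vs = a ∷ b ∷ c ∷ d ∷ []
  distinct : Unique vs
  distinct = (edge⇒≢ G irr ab ∷ a≢c ∷ ≢-sym (edge⇒≢ G irr da) ∷ [])
           ∷ (edge⇒≢ G irr bc ∷ b≢d ∷ []) ∷ (edge⇒≢ G irr cd ∷ []) ∷ [] ∷ []
  edges : (i : Fin 3) → G (lookup vs (inject₁ i)) (lookup vs (suc i)) ≡ true
  edges zero             = ab
  edges (suc zero)       = bc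
  edges (suc (suc zero)) = cd

-- in an acyclic graph every 4-vertex path is induced, so it has score 2
acyclic-path4-score : ∀ {n} (G : Graph n) → Symmetric G → Irreflexive G → Acyclic G →
  (p : Path4 G) → score G (setOf (Path4.vertices p)) ≡ 2
acyclic-path4-score G symG irr acyc p =
  induced-path4-score G symG irr p
    (¬-not λ ca → acyclic⇒triangle-free G irr acyc ab bc ca)
    (¬-not λ ad → acyclic⇒square-free G irr acyc ab bc cd (trans (symG d a) ad) a≢c b≢d)
    (¬-not λ db → acyclic⇒triangle-free G irr acyc bc cd db)
  where open Path4 p

Dominating : ∀ {n} → Graph n → Fin n → Set
Dominating {n} G c = ∀ i → i ≢ c → G c i ≡ true

-- Every vertex is u or a neighbour of u or of x, and u, x cannot both have a
-- private neighbour (they would extend ux to a 4-vertex path), so u or x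
-- is adjacent to all other vertices.
module EdgeDominates {n} (G : Graph n) (symG : Symmetric G) (conn : Connected G)
  (tf : TriangleFree G) (noPath : ¬ Path4 G) {u x : Fin n} (ux : G u x ≡ true) where

  Near : Fin n → Set
  Near y = y ≡ u ⊎ G u y ≡ true ⊎ G x y ≡ true

  near-closed : ∀ {w z} → Near w → G w z ≡ true → Near z
  near-closed (inj₁ refl) wz = inj₂ (inj₁ wz)
  near-closed {w} {z} (inj₂ (inj₁ uw)) wz with ≡-or-≢ w x | ≡-or-≢ z u | ≡-or-≢ z x
  ... | inj₁ refl | _         | _         = inj₂ (inj₂ wz)
  ... | inj₂ _    | inj₁ z≡u  | _         = inj₁ z≡u
  ... | inj₂ _    | inj₂ _    | inj₁ refl = inj₂ (inj₁ ux)
  ... | inj₂ w≢x  | inj₂ z≢u  | inj₂ z≢x  =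
    ⊥-elim (noPath (path4 x u w z (trans (symG x u) ux) uw wz (≢-sym w≢x) (≢-sym z≢u) (≢-sym z≢x)))
  near-closed {w} {z} (inj₂ (inj₂ xw)) wz with ≡-or-≢ z u | ≡-or-≢ z x | ≡-or-≢ w u
  ... | inj₁ z≡u  | _         | _         = inj₁ z≡u
  ... | inj₂ _    | inj₁ refl | _         = inj₂ (inj₁ ux)
  ... | inj₂ _    | inj₂ _    | inj₁ refl = inj₂ (inj₁ wz)
  ... | inj₂ z≢u  | inj₂ z≢x  | inj₂ w≢u  =
    ⊥-elim (noPath (path4 u x w z ux xw wz (≢-sym w≢u) (≢-sym z≢x) (≢-sym z≢u)))

  everyone-near : ∀ y → Near y
  everyone-near y = Walk.transport G (fullSet n) Near near-closed n (inj₁ refl) (to T-≡ (conn u y))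

  dominating : Σ (Fin n) (Dominating G)
  dominating with any? (λ a → (G u a ≟ᵇ true) ×-dec ¬? (a ≟ x))
                | any? (λ b → (G x b ≟ᵇ true) ×-dec ¬? (b ≟ u))
  ... | no no-private-u | _ = x , x-dominates
    where
    x-dominates : Dominating G x
    x-dominates i i≢x with everyone-near i
    ... | inj₁ refl        = trans (symG x i) ux
    ... | inj₂ (inj₁ ui)   = ⊥-elim (no-private-u (i , ui , i≢x))
    ... | inj₂ (inj₂ xi)   = xi
  ... | yes _ | no no-private-x = u , u-dominates
    where
    u-dominates : Dominating G u
    u-dominates i i≢u with everyone-near i
    ... | inj₁ i≡u         = ⊥-elim (i≢u i≡u)
    ... | inj₂ (inj₁ ui)   = ui
    ... | inj₂ (inj₂ xi)   = ⊥-elim (no-private-x (i , xi , i≢u))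
  ... | yes (a , ua , a≢x) | yes (b , xb , b≢u) =
    ⊥-elim (noPath (path4 a u x b (trans (symG a u) ua) ux xb a≢x (≢-sym b≢u) a≢b))
    where
    a≢b : a ≢ b
    a≢b refl = tf ux xb (trans (symG a u) ua)

dominating-vertex : ∀ {m} (G : Graph (suc m)) → Symmetric G → Connected G → TriangleFree G →
  ¬ Path4 G → Σ (Fin (suc m)) (Dominating G)
dominating-vertex {zero}  G _ _ _ _ = zero , λ { zero 0≢0 → ⊥-elim (0≢0 refl) }
dominating-vertex {suc m} G symG conn tf noPath
  with Walk.first-step G (fullSet (suc (suc m))) {suc (suc m)} {zero} {suc zero}
         (to T-≡ (conn zero (suc zero))) (λ ())
... | x , _ , 0x = EdgeDominates.dominating G symG conn tf noPath 0x

nonzero⇒suc : ∀ {m} (k : Fin (suc m)) → k ≢ zero → Σ (Fin m) λ j → k ≡ suc j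
nonzero⇒suc zero    k≢0 = ⊥-elim (k≢0 refl)
nonzero⇒suc (suc j) _   = j , refl

-- A triangle-free graph with a dominating vertex c is the star centred at c:
-- the transposition of c and 0 maps it onto star m.
dominating⇒star : ∀ {m} (G : Graph (suc m)) → Symmetric G → Irreflexive G → TriangleFree G →
  ∀ {c} → Dominating G c → Isomorphic G (star m)
dominating⇒star {m} G symG irr tf {c} dom = π , preserves
  where
  π = transpose c zero

  π-centre : π ⟨$⟩ʳ c ≡ zero
  π-centre with c ≟ c
  ... | yes _   = refl
  ... | no  c≢c = ⊥-elim (c≢c refl)

  π-leaf : ∀ k → k ≢ c → Σ (Fin m) λ j → π ⟨$⟩ʳ k ≡ suc j
  π-leaf k k≢c with k ≟ c
  ... | yes k≡c = ⊥-elim (k≢c k≡c)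
  ... | no _ with k ≟ zero
  ... | yes refl = nonzero⇒suc c (≢-sym k≢c)
  ... | no  k≢0  = nonzero⇒suc k k≢0

  preserves : ∀ i j → star m (π ⟨$⟩ʳ i) (π ⟨$⟩ʳ j) ≡ G i j
  preserves i j with ≡-or-≢ i c | ≡-or-≢ j c
  ... | inj₁ refl | inj₁ refl rewrite π-centre = sym (irr i)
  ... | inj₁ refl | inj₂ j≢c with π-leaf j j≢c
  ...   | _ , πj rewrite π-centre | πj = sym (dom j j≢c)
  preserves i j | inj₂ i≢c | inj₁ refl with π-leaf i i≢c
  ...   | _ , πi rewrite π-centre | πi = sym (trans (symG i j) (dom i i≢c))
  preserves i j | inj₂ i≢c | inj₂ j≢c with π-leaf i i≢c | π-leaf j j≢c
  ...   | _ , πi | _ , πj rewrite πi | πj =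
    sym (¬-not λ ij → tf (dom i i≢c) ij (trans (symG j c) (dom j j≢c)))

-- If T has a 4-vertex path P, the star's score is pointwise at most T's and
-- strictly smaller on V(P); otherwise T is triangle-free without such paths,
-- hence isomorphic to the star.
corollary2 : (m : ℕ) → (T : Graph (suc m)) → IsTree T → ¬ Isomorphic T (star m) →
    η (star m) + η (complement (star m)) < η T + η (complement T)
corollary2 m T ((symT , irrT) , connT , acycT) notStar with path4? T
... | no noPath = ⊥-elim (notStar (dominating⇒star T symT irrT tf (proj₂ centre)))
  where
  tf = acyclic⇒triangle-free T irrT acycT
  centre = dominating-vertex T symT connT tf noPath
... | yes p =
  η-sum-< (star m) T (star-score-minimal m T symT (order≥4 irrT)) (setOf vertices) star<T
  where
  open Path4 p
  star<T : score (star m) (setOf vertices) < score T (setOf vertices)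
  star<T = <-≤-trans
    (s≤s (star-score≤1 m (setOf vertices) (∈-setOf⁺ vertices (here refl))
                         (∈-setOf⁺ vertices (there (here refl))) (edge⇒≢ T irrT ab)))
    (≤-reflexive (sym (acyclic-path4-score T symT irrT acycT p)))
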